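{- Let $m$ be a fixed positive integer. The generating function for the number $c_m(n)$ of monotone paths of length $n$ in the strip of height $m$ is \[ \sum_{n \geq 0} c_m(n)x^n = \frac{\det(I-x A_m \, ; \, 00)}{\det(I-x A_m)}, \] where $(I-xA_m \, ; \, 00)$ is the matrix obtained from $I-xA_m$ by replacing every entry in the first column (the column indexed by $(0,0)$) with a $1$.
   Context: The strip of height $m$ is $\{(x,y)\in\mathbb{Z}^2 : x\ge 0,\ 0\le y\le m\}$. A monotone path of length $n$ in the strip of height $m$ is a lattice path that starts at $(0,0)$, takes $n$ steps, each equal to $N=(0,1)$, $S=(0,-1)$ or $E=(1,0)$, never retraces steps (no $N$ immediately followed by $S$ and no $S$ immediately by $N$), and stays within the strip; $c_m(n)$ is their number ($c_m(0)=1$). The transfer graph $G_m$ is the directed graph whose vertices are the pairs $(i,j)$ with $i,j\in\{0,\dots,m\}$ and $j\in\{i-1,i,i+1\}$, with an edge $(i,j)\to(j,k)$ for all such vertices unless $j=i\pm1$ and $k=i$ (loops allowed). $A_m$ is its adjacency matrix, with rows and columns indexed by the vertices and the vertex $(0,0)$ listed first. -}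

module Defs where

open import Data.Nat as ℕ using (ℕ; zero; suc; _∸_; _≡ᵇ_)
open import Data.Integer as ℤ using (ℤ; +_; -_)
open import Data.Bool using (Bool; true; false; _∧_; _∨_; not; if_then_else_)
open import Data.List as List using (List; []; _∷_; map; filter; length; concatMap; upTo; lookup)
open import Data.Fin as Fin using (Fin; punchIn)
open import Data.Maybe using (Maybe; just; nothing)
open import Relation.Nullary.Decidable using (does)
open import Relation.Binary.PropositionalEquality using (_≡_)
open import Data.Bool.Properties using (T?)
open import Data.Bool using (T)

data Step : Set where
  N S E : Step

words : ℕ → List (List Step)
words zero    = [] ∷ []
words (suc n) = concatMap (λ w → (N ∷ w) ∷ (S ∷ w) ∷ (E ∷ w) ∷ []) (words n)

retraces : Maybe Step → Step → Bool
retraces (just N) S = true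
retraces (just S) N = true
retraces _        _ = false

-- validFrom m y prev w : walking w from height y (previous step prev)
-- never retraces and keeps the height within [0, m].
-- (The x-coordinate never decreases, so x ≥ 0 holds automatically.)
validFrom : ℕ → ℕ → Maybe Step → List Step → Bool
validFrom m y p []        = true
validFrom m y p (N ∷ w)   =
  not (retraces p N) ∧ (does (suc y ℕ.≤? m)) ∧ validFrom m (suc y) (just N) w
validFrom m zero p (S ∷ w)    = false
validFrom m (suc y) p (S ∷ w) =
  not (retraces p S) ∧ validFrom m y (just S) w
validFrom m y p (E ∷ w)   = validFrom m y (just E) w

isMonotonePath : ℕ → List Step → Bool
isMonotonePath m w = validFrom m 0 nothing w

c : ℕ → ℕ → ℕ
c m n = length (filter (λ w → T? (isMonotonePath m w)) (words n))

-- Formal power series over ℤ (polynomials are the finitely supported ones)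

FPS : Set
FPS = ℕ → ℤ

sumℤ : List ℤ → ℤ
sumℤ = List.foldr ℤ._+_ (+ 0)

0ₚ 1ₚ X : FPS
0ₚ n = + 0
1ₚ zero = + 1
1ₚ (suc n) = + 0
X (suc zero) = + 1
X _ = + 0

_+ₚ_ : FPS → FPS → FPS
(f +ₚ g) n = f n ℤ.+ g n

-ₚ_ : FPS → FPS
(-ₚ f) n = - f n

_-ₚ_ : FPS → FPS → FPS
f -ₚ g = f +ₚ (-ₚ g)

_*ₚ_ : FPS → FPS → FPS
(f *ₚ g) n = sumℤ (map (λ i → f i ℤ.* g (n ∸ i)) (upTo (suc n)))

constₚ : ℤ → FPS
constₚ a zero    = a
constₚ a (suc n) = + 0

Matrix : ℕ → Set
Matrix k = Fin k → Fin k → FPS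

sumFin : ∀ {k} → (Fin k → FPS) → FPS
sumFin {zero}  f = 0ₚ
sumFin {suc k} f = f Fin.zero +ₚ sumFin (λ i → f (Fin.suc i))

sign : ∀ {k} → Fin k → FPS
sign Fin.zero    = 1ₚ
sign (Fin.suc i) = -ₚ sign i

det : ∀ {k} → Matrix k → FPS
det {zero}  M = 1ₚ
det {suc k} M =
  sumFin (λ i → (sign i *ₚ M i Fin.zero) *ₚ det (λ r s → M (punchIn i r) (Fin.suc s)))

-- vertices (i , j), 0 ≤ i,j ≤ m, j ∈ {i-1,i,i+1}, listed lexicographically
-- (so (0,0) is listed first)
open import Data.Product using (_×_; _,_; proj₁; proj₂)

near : ℕ → ℕ → Bool
near i j = (i ≡ᵇ j) ∨ (suc i ≡ᵇ j) ∨ (i ≡ᵇ suc j)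

vertices : ℕ → List (ℕ × ℕ)
vertices m =
  concatMap (λ i → map (λ j → (i , j)) (filter (λ j → T? (near i j)) (upTo (suc m))))
            (upTo (suc m))

nV : ℕ → ℕ
nV m = length (vertices m)

vertex : (m : ℕ) → Fin (nV m) → ℕ × ℕ
vertex m = lookup (vertices m)

edge : ℕ × ℕ → ℕ × ℕ → Bool
edge (i , j) (j' , k) =
  (j ≡ᵇ j') ∧ not (((suc i ≡ᵇ j) ∨ (i ≡ᵇ suc j)) ∧ (k ≡ᵇ i))

A : (m : ℕ) → Fin (nV m) → Fin (nV m) → ℤ
A m a b = if edge (vertex m a) (vertex m b) then + 1 else + 0

δ : ∀ {k} → Fin k → Fin k → ℤ
δ a b = if does (a Fin.≟ b) then + 1 else + 0

I-xA : (m : ℕ) → Matrix (nV m)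
I-xA m a b = constₚ (δ a b) -ₚ (X *ₚ constₚ (A m a b))

-- (M ; 00): replace every entry of the first column (index 0, the vertex
-- (0,0)) by the constant 1
replaceFirstCol : ∀ {k} → Matrix k → Matrix k
replaceFirstCol M a b = if (Fin.toℕ b ≡ᵇ 0) then 1ₚ else M a b

C : ℕ → FPS
C m n = + (c m n)

{-# OPTIONS --safe #-}

-- A vertex (i , j) of G_m is the state of a path that has just moved from
-- height i to height j.  Let Y_v be the generating function of the words that
-- can continue a path in state v.  Splitting off the first step gives
-- Y_v = 1 + x Σ_w (A_m)_{vw} Y_w, i.e. (I - x A_m) Y = 1, and C = Y_(0,0).
-- Cramer's rule for the first unknown then gives
-- det (I - x A_m) · Y_(0,0) = det (I - x A_m ; 00).  The
-- alternating property needed for Cramer's rule follows from antisymmetry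
-- under swapping the first two columns, since ℤ[[x]] has no 2-torsion; and
-- antisymmetry holds because expanding along both columns pairs each term
-- with its negative.
module Submission where

open import Defs
open import Data.Nat using (ℕ; _≤_)
open import Relation.Binary.PropositionalEquality using (_≡_)
open import Algebra.Bundles using (CommutativeRing)

module FinProperties where

  open import Data.Nat using (zero; suc)
  open import Data.Fin using (Fin; zero; suc; punchIn; punchOut)
  open import Data.Fin.Properties using (punchIn-punchOut)
  open import Data.Vec.Functional using (Vector; insertAt)
  open import Data.Vec.Functional.Properties using (insertAt-punchIn)
  open import Function using (_∘_)
  open import Relation.Binary.PropositionalEquality
  open import Relation.Nullary using (contradiction)

  punchIn-punchOut-comm : ∀ {n} {i j : Fin (suc (suc n))} (i≢j : i ≢ j) (j≢i : j ≢ i) (t : Fin n) →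
    punchIn i (punchIn (punchOut i≢j) t) ≡ punchIn j (punchIn (punchOut j≢i) t)
  punchIn-punchOut-comm {_}     {zero}  {zero}  i≢j _   _       = contradiction refl i≢j
  punchIn-punchOut-comm {_}     {zero}  {suc j} _   _   _       = refl
  punchIn-punchOut-comm {_}     {suc i} {zero}  _   _   _       = refl
  punchIn-punchOut-comm {suc n} {suc i} {suc j} _   _   zero    = refl
  punchIn-punchOut-comm {suc n} {suc i} {suc j} i≢j j≢i (suc t) =
    cong suc (punchIn-punchOut-comm (i≢j ∘ cong suc) (j≢i ∘ cong suc) t)

  insertAt-punchOut : ∀ {a} {A : Set a} {n} (xs : Vector A n) {i j : Fin (suc n)} (v : A) (i≢j : i ≢ j) →
    insertAt xs i v j ≡ xs (punchOut i≢j)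
  insertAt-punchOut xs {i} v i≢j =
    trans (cong (insertAt xs i v) (sym (punchIn-punchOut i≢j))) (insertAt-punchIn xs i v _)

module Determinant {c ℓ} (R : CommutativeRing c ℓ) where

  open import Data.Nat using (ℕ; zero; suc)
  open import Level using (_⊔_)
  open import Data.Fin using (Fin; zero; suc; punchIn; punchOut; _≟_)
  open import Data.Fin.Properties using (punchIn-punchOut)
  open FinProperties
  open import Data.Vec.Functional using (insertAt)
  open import Data.Vec.Functional.Properties using (insertAt-lookup; insertAt-punchIn)
  open import Data.Maybe using (nothing)
  open import Function using (_∘_)
  open import Relation.Binary.PropositionalEquality as ≡ using (_≢_)
  open import Relation.Nullary using (yes; no; contradiction)

  -- The reflective solver only recognises the operations of the
  -- AlmostCommutativeRing it is given, so its lemmas are stated over that view.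
  private
    module Solver where
      open import Tactic.RingSolver.Core.AlmostCommutativeRing
      open import Tactic.RingSolver using (solve-∀)
      R-almostCommutativeRing : AlmostCommutativeRing c ℓ
      R-almostCommutativeRing = fromCommutativeRing R (λ _ → nothing)
      open AlmostCommutativeRing R-almostCommutativeRing

      collect : ∀ a b c d x y e → (a * x) * ((b * y) * e) + (c * y) * ((d * x) * e) ≈ (a * b + c * d) * (x * y * e)
      collect = solve-∀ R-almostCommutativeRing

  open CommutativeRing R hiding (zero)
  open import Algebra.Properties.Semiring.Sum semiring
  open import Relation.Binary.Reasoning.Setoid setoid
  open import Algebra.Properties.Ring ring using (-‿distribˡ-*; -‿distribʳ-*; -‿involutive)

  Mat : ℕ → Set c
  Mat k = Fin k → Fin k → Carrier

  sgn : ∀ {k} → Fin k → Carrier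
  sgn zero    = 1#
  sgn (suc i) = - sgn i

  minor : ∀ {k} → Mat (suc k) → Fin (suc k) → Mat k
  minor M i r s = M (punchIn i r) (suc s)

  determinant : ∀ {k} → Mat k → Carrier
  cofactorTerm : ∀ {k} → Mat (suc k) → Fin (suc k) → Carrier

  determinant {zero}  M = 1#
  determinant {suc k} M = sum (cofactorTerm M)

  cofactorTerm M i = (sgn i * M i zero) * determinant (minor M i)

  determinant-cong : ∀ {k} {M N : Mat k} → (∀ r s → M r s ≈ N r s) → determinant M ≈ determinant N
  determinant-cong {zero}  M≈N = refl
  determinant-cong {suc k} M≈N = sum-cong-≋ λ i →
    *-cong (*-congˡ {sgn i} (M≈N i zero)) (determinant-cong λ r s → M≈N (punchIn i r) (suc s))

  sum-zero : ∀ {k} {f : Fin k → Carrier} → (∀ i → f i ≈ 0#) → sum f ≈ 0#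
  sum-zero {k} f≈0 = trans (sum-cong-≋ f≈0) (sum-replicate-zero k)

  sum-insertAt-0# : ∀ {k} (f : Fin k → Carrier) (i : Fin (suc k)) → sum (insertAt f i 0#) ≈ sum f
  sum-insertAt-0# f i = begin
    sum (insertAt f i 0#)                                       ≈⟨ sum-remove (insertAt f i 0#) ⟩
    insertAt f i 0# i + sum (insertAt f i 0# ∘ punchIn i)     ≡⟨ ≡.cong₂ _+_ (insertAt-lookup f i 0#)
                                                                   (sum-cong-≗ (insertAt-punchIn f i 0#)) ⟩
    0# + sum f                                                  ≈⟨ +-identityˡ (sum f) ⟩
    sum f                                                       ∎

  -x*-y≈x*y : ∀ x y → - x * - y ≈ x * y
  -x*-y≈x*y x y = begin
    - x * - y      ≈⟨ -‿distribˡ-* x (- y) ⟨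
    - (x * - y)    ≈⟨ -‿cong (-‿distribʳ-* x y) ⟨
    - - (x * y)    ≈⟨ -‿involutive (x * y) ⟩
    x * y          ∎

  sgn-punchOut : ∀ {k} {i j : Fin (suc (suc k))} (i≢j : i ≢ j) (j≢i : j ≢ i) →
    sgn i * sgn (punchOut i≢j) + sgn j * sgn (punchOut j≢i) ≈ 0#
  sgn-punchOut {_}     {zero}  {zero}  i≢j _   = contradiction ≡.refl i≢j
  sgn-punchOut {_}     {zero}  {suc j} _   _   =
    trans (+-cong (*-identityˡ (sgn j)) (*-identityʳ (- sgn j))) (-‿inverseʳ (sgn j))
  sgn-punchOut {_}     {suc i} {zero}  _   _   =
    trans (+-cong (*-identityʳ (- sgn i)) (*-identityˡ (sgn i))) (-‿inverseˡ (sgn i))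
  sgn-punchOut {zero}  {suc zero} {suc zero} i≢j _ = contradiction ≡.refl i≢j
  sgn-punchOut {suc k} {suc i} {suc j} i≢j j≢i =
    trans (+-cong (-x*-y≈x*y (sgn i) _) (-x*-y≈x*y (sgn j) _))
          (sgn-punchOut (i≢j ∘ ≡.cong suc) (j≢i ∘ ≡.cong suc))

  swap01 : ∀ {k} → Fin (suc (suc k)) → Fin (suc (suc k))
  swap01 zero          = suc zero
  swap01 (suc zero)    = zero
  swap01 (suc (suc s)) = suc (suc s)

  -- Expanding along columns 0 and 1 gives a sum over pairs of distinct rows;
  -- pairTerm indexes it by both rows, with 0# on the diagonal.
  crossTerm : ∀ {k} → Mat (suc (suc k)) → Fin (suc (suc k)) → Fin (suc k) → Carrier
  crossTerm M i r = (sgn i * M i zero) * cofactorTerm (minor M i) r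

  pairTerm : ∀ {k} → Mat (suc (suc k)) → Fin (suc (suc k)) → Fin (suc (suc k)) → Carrier
  pairTerm M i = insertAt (crossTerm M i) i 0#

  determinant≈∑pairTerm : ∀ {k} (M : Mat (suc (suc k))) →
    determinant M ≈ ∑[ i < suc (suc k) ] ∑[ j < suc (suc k) ] pairTerm M i j
  determinant≈∑pairTerm M = sum-cong-≋ λ i → begin
    (sgn i * M i zero) * determinant (minor M i)   ≈⟨ *-distribˡ-sum (sgn i * M i zero) (cofactorTerm (minor M i)) ⟩
    sum (crossTerm M i)                             ≈⟨ sum-insertAt-0# (crossTerm M i) i ⟨
    sum (pairTerm M i)                              ∎

  pairTerm-swap01 : ∀ {k} (M : Mat (suc (suc k))) (i j : Fin (suc (suc k))) →
    pairTerm (λ r s → M r (swap01 s)) i j + pairTerm M j i ≈ 0#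
  pairTerm-swap01 M i j with i ≟ j
  ... | yes ≡.refl = begin
    pairTerm M′ i i + pairTerm M i i
      ≡⟨ ≡.cong₂ _+_ (insertAt-lookup (crossTerm M′ i) i 0#) (insertAt-lookup (crossTerm M i) i 0#) ⟩
    0# + 0#
      ≈⟨ +-identityˡ 0# ⟩
    0# ∎
    where
    M′ = λ r s → M r (swap01 s)
  ... | no i≢j = begin
    pairTerm M′ i j + pairTerm M j i
      ≡⟨ ≡.cong₂ _+_ (insertAt-punchOut (crossTerm M′ i) 0# i≢j) (insertAt-punchOut (crossTerm M j) 0# j≢i) ⟩
    crossTerm M′ i r + crossTerm M j r′
      ≡⟨ ≡.cong₂ (λ a b → (sgn i * x) * ((sgn r * M a zero) * D) + (sgn j * y) * ((sgn r′ * M b (suc zero)) * D′))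
                 (punchIn-punchOut i≢j) (punchIn-punchOut j≢i) ⟩
    (sgn i * x) * ((sgn r * y) * D) + (sgn j * y) * ((sgn r′ * x) * D′)
      ≈⟨ +-congˡ (*-congˡ (*-congˡ D′≈D)) ⟩
    (sgn i * x) * ((sgn r * y) * D) + (sgn j * y) * ((sgn r′ * x) * D)
      ≈⟨ Solver.collect (sgn i) (sgn r) (sgn j) (sgn r′) x y D ⟩
    (sgn i * sgn r + sgn j * sgn r′) * (x * y * D)
      ≈⟨ *-congʳ (sgn-punchOut i≢j j≢i) ⟩
    0# * (x * y * D)
      ≈⟨ zeroˡ _ ⟩
    0# ∎
    where
    M′ = λ r s → M r (swap01 s)
    j≢i = i≢j ∘ ≡.sym
    r = punchOut i≢j
    r′ = punchOut j≢i
    x = M i (suc zero)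
    y = M j zero
    D = determinant (minor (minor M i) r)
    D′ = determinant (minor (minor M j) r′)
    D′≈D : D′ ≈ D
    D′≈D = determinant-cong λ t s →
      reflexive (≡.cong (λ a → M a (suc (suc s))) (punchIn-punchOut-comm j≢i i≢j t))

  determinant-swap01 : ∀ {k} (M : Mat (suc (suc k))) →
    determinant (λ r s → M r (swap01 s)) + determinant M ≈ 0#
  determinant-swap01 {k} M = begin
    determinant M′ + determinant M
      ≈⟨ +-cong (determinant≈∑pairTerm M′) (determinant≈∑pairTerm M) ⟩
    ∑[ i < n ] ∑[ j < n ] pairTerm M′ i j + ∑[ j < n ] ∑[ i < n ] pairTerm M j i
      ≈⟨ +-congˡ (∑-comm (λ j i → pairTerm M j i)) ⟩
    ∑[ i < n ] ∑[ j < n ] pairTerm M′ i j + ∑[ i < n ] ∑[ j < n ] pairTerm M j i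
      ≈⟨ ∑-distrib-+ (λ i → ∑[ j < n ] pairTerm M′ i j) (λ i → ∑[ j < n ] pairTerm M j i) ⟨
    ∑[ i < n ] (∑[ j < n ] pairTerm M′ i j + ∑[ j < n ] pairTerm M j i)
      ≈⟨ sum-cong-≋ (λ i → ∑-distrib-+ (pairTerm M′ i) (λ j → pairTerm M j i)) ⟨
    ∑[ i < n ] ∑[ j < n ] (pairTerm M′ i j + pairTerm M j i)
      ≈⟨ sum-zero (λ i → sum-zero (pairTerm-swap01 M i)) ⟩
    0# ∎
    where
    n = suc (suc k)
    M′ = λ r s → M r (swap01 s)

  _[col0≔_] : ∀ {k} → Mat (suc k) → (Fin (suc k) → Carrier) → Mat (suc k)
  (M [col0≔ u ]) r zero    = u r
  (M [col0≔ u ]) r (suc s) = M r (suc s)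

  determinant-col0-linear : ∀ {k} (M : Mat (suc k)) (v : Mat (suc k)) (y : Fin (suc k) → Carrier) →
    determinant (M [col0≔ (λ a → ∑[ b < suc k ] (v a b * y b)) ]) ≈
    ∑[ b < suc k ] (determinant (M [col0≔ (λ a → v a b) ]) * y b)
  determinant-col0-linear {k} M v y = begin
    ∑[ i < suc k ] ((sgn i * ∑[ b < suc k ] (v i b * y b)) * D i)
      ≈⟨ sum-cong-≋ expand ⟩
    ∑[ i < suc k ] ∑[ b < suc k ] (((sgn i * v i b) * D i) * y b)
      ≈⟨ ∑-comm (λ i b → ((sgn i * v i b) * D i) * y b) ⟩
    ∑[ b < suc k ] ∑[ i < suc k ] (((sgn i * v i b) * D i) * y b)
      ≈⟨ sum-cong-≋ (λ b → *-distribʳ-sum (y b) (λ i → (sgn i * v i b) * D i)) ⟨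
    ∑[ b < suc k ] ((∑[ i < suc k ] ((sgn i * v i b) * D i)) * y b) ∎
    where
    D = determinant ∘ minor M
    regroup : ∀ s v y d → (s * (v * y)) * d ≈ ((s * v) * d) * y
    regroup s v y d = begin
      (s * (v * y)) * d    ≈⟨ *-congʳ (*-assoc s v y) ⟨
      ((s * v) * y) * d    ≈⟨ *-assoc (s * v) y d ⟩
      (s * v) * (y * d)    ≈⟨ *-congˡ (*-comm y d) ⟩
      (s * v) * (d * y)    ≈⟨ *-assoc (s * v) d y ⟨
      ((s * v) * d) * y    ∎
    expand : ∀ i → (sgn i * ∑[ b < suc k ] (v i b * y b)) * D i ≈ ∑[ b < suc k ] (((sgn i * v i b) * D i) * y b)
    expand i = begin
      (sgn i * ∑[ b < suc k ] (v i b * y b)) * D i   ≈⟨ *-congʳ (*-distribˡ-sum (sgn i) (λ b → v i b * y b)) ⟩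
      (∑[ b < suc k ] (sgn i * (v i b * y b))) * D i ≈⟨ *-distribʳ-sum (D i) (λ b → sgn i * (v i b * y b)) ⟩
      ∑[ b < suc k ] ((sgn i * (v i b * y b)) * D i) ≈⟨ sum-cong-≋ (λ b → regroup (sgn i) (v i b) (y b) (D i)) ⟩
      ∑[ b < suc k ] (((sgn i * v i b) * D i) * y b) ∎

  2-torsion-free : Set (c ⊔ ℓ)
  2-torsion-free = ∀ x → x + x ≈ 0# → x ≈ 0#

  module _ (no-2-torsion : 2-torsion-free) where

    determinant-repeated-col0 : ∀ {k} (b : Fin k) (M : Mat (suc k)) →
      (∀ r → M r (suc b) ≈ M r zero) → determinant M ≈ 0#
    determinant-repeated-col0 zero M col₁≈col₀ = no-2-torsion (determinant M) (begin
      determinant M + determinant M    ≈⟨ +-congʳ (determinant-cong M≈M′) ⟩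
      determinant M′ + determinant M   ≈⟨ determinant-swap01 M ⟩
      0#                               ∎)
      where
      M′ = λ r s → M r (swap01 s)
      M≈M′ : ∀ r s → M r s ≈ M′ r s
      M≈M′ r zero          = sym (col₁≈col₀ r)
      M≈M′ r (suc zero)    = col₁≈col₀ r
      M≈M′ r (suc (suc s)) = refl
    determinant-repeated-col0 (suc b) M col≈col₀ = begin
      determinant M                      ≈⟨ +-identityˡ (determinant M) ⟨
      0# + determinant M                 ≈⟨ +-congʳ det-M′≈0 ⟨
      determinant M′ + determinant M     ≈⟨ determinant-swap01 M ⟩
      0#                                 ∎
      where
      M′ = λ r s → M r (swap01 s)
      -- after the swap, the equal columns 1 and b + 2 survive in every minor
      det-M′≈0 : determinant M′ ≈ 0#
      det-M′≈0 = sum-zero λ i → trans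
        (*-congˡ {sgn i * M′ i zero} (determinant-repeated-col0 b (minor M′ i) (col≈col₀ ∘ punchIn i)))
        (zeroʳ _)

    cramer-col0 : ∀ {k} (M : Mat (suc k)) (y u : Fin (suc k) → Carrier) →
      (∀ a → ∑[ b < suc k ] (M a b * y b) ≈ u a) → determinant M * y zero ≈ determinant (M [col0≔ u ])
    cramer-col0 {k} M y u My≈u = begin
      determinant M * y zero
        ≈⟨ +-identityʳ _ ⟨
      determinant M * y zero + 0#
        -- M [col0≔ column zero ] has the same first-column expansion as M
        ≈⟨ +-congˡ (sum-zero λ b → trans (*-congʳ (repeated b)) (zeroˡ _)) ⟨
      ∑[ b < suc k ] (determinant (M [col0≔ column b ]) * y b)
        ≈⟨ determinant-col0-linear M M y ⟨
      determinant (M [col0≔ (λ a → ∑[ b < suc k ] (M a b * y b)) ])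
        ≈⟨ determinant-cong My≈u-col0 ⟩
      determinant (M [col0≔ u ]) ∎
      where
      column : Fin (suc k) → Fin (suc k) → Carrier
      column b a = M a b
      repeated : ∀ b → determinant (M [col0≔ column (suc b) ]) ≈ 0#
      repeated b = determinant-repeated-col0 b (M [col0≔ column (suc b) ]) (λ _ → refl)
      My≈u-col0 : ∀ r s → (M [col0≔ (λ a → ∑[ b < suc k ] (M a b * y b)) ]) r s ≈ (M [col0≔ u ]) r s
      My≈u-col0 r zero    = My≈u r
      My≈u-col0 r (suc s) = refl

module PowerSeries where

  open import Data.Nat as ℕ using (ℕ; zero; suc)
  open import Data.Integer using (ℤ; +_; 0ℤ; 1ℤ; _+_; _-_; _*_)
  import Data.Integer.Properties as ℤ
  open import Data.Integer.Tactic.RingSolver using (solve-∀)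
  open import Algebra.Properties.CommutativeSemigroup ℤ.+-commutativeSemigroup
    using () renaming (interchange to +-interchange; x∙yz≈y∙xz to +-exchange)
  open import Data.List using (map; upTo; applyUpTo)
  open import Data.List.Properties using (map-applyUpTo)
  open import Function using (_∘_; id)
  open import Algebra.Structures using (IsCommutativeRing)
  import Algebra.Construct.Pointwise ℕ as Pointwise
  open import Data.Product using (_,_)
  open import Level using (0ℓ)
  open import Relation.Binary.PropositionalEquality
  open ≡-Reasoning

  infix 4 _≈ₚ_
  _≈ₚ_ : FPS → FPS → Set
  f ≈ₚ g = ∀ n → f n ≡ g n

  shift : FPS → FPS
  shift f n = f (suc n)

  scale : ℤ → FPS → FPS
  scale a f n = a * f n

  *ₚ-coeff-zero : ∀ f g → (f *ₚ g) 0 ≡ f 0 * g 0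
  *ₚ-coeff-zero f g = ℤ.+-identityʳ _

  *ₚ-coeff-suc : ∀ f g n → (f *ₚ g) (suc n) ≡ f 0 * g (suc n) + (shift f *ₚ g) n
  *ₚ-coeff-suc f g n = cong (λ l → f 0 * g (suc n) + sumℤ l) (begin
    map (λ i → f i * g (suc n ℕ.∸ i)) (applyUpTo suc (suc n))
      ≡⟨ map-applyUpTo suc _ (suc n) ⟩
    applyUpTo (λ i → f (suc i) * g (n ℕ.∸ i)) (suc n)
      ≡⟨ map-applyUpTo id _ (suc n) ⟨
    map (λ i → f (suc i) * g (n ℕ.∸ i)) (upTo (suc n)) ∎)

  *ₚ-cong : ∀ {f f′ g g′} → f ≈ₚ f′ → g ≈ₚ g′ → f *ₚ g ≈ₚ f′ *ₚ g′
  *ₚ-cong {f} {f′} {g} {g′} f≈ g≈ zero = begin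
    (f *ₚ g) 0     ≡⟨ *ₚ-coeff-zero f g ⟩
    f 0 * g 0      ≡⟨ cong₂ _*_ (f≈ 0) (g≈ 0) ⟩
    f′ 0 * g′ 0    ≡⟨ *ₚ-coeff-zero f′ g′ ⟨
    (f′ *ₚ g′) 0   ∎
  *ₚ-cong {f} {f′} {g} {g′} f≈ g≈ (suc n) = begin
    (f *ₚ g) (suc n)                         ≡⟨ *ₚ-coeff-suc f g n ⟩
    f 0 * g (suc n) + (shift f *ₚ g) n       ≡⟨ cong₂ _+_ (cong₂ _*_ (f≈ 0) (g≈ (suc n)))
                                                          (*ₚ-cong (f≈ ∘ suc) g≈ n) ⟩
    f′ 0 * g′ (suc n) + (shift f′ *ₚ g′) n   ≡⟨ *ₚ-coeff-suc f′ g′ n ⟨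
    (f′ *ₚ g′) (suc n)                       ∎

  *ₚ-zeroˡ : ∀ g → 0ₚ *ₚ g ≈ₚ 0ₚ
  *ₚ-zeroˡ g zero    = *ₚ-coeff-zero 0ₚ g
  *ₚ-zeroˡ g (suc n) = begin
    (0ₚ *ₚ g) (suc n)               ≡⟨ *ₚ-coeff-suc 0ₚ g n ⟩
    0ℤ * g (suc n) + (0ₚ *ₚ g) n    ≡⟨ cong (_+_ 0ℤ) (*ₚ-zeroˡ g n) ⟩
    0ℤ                              ∎

  *ₚ-identityˡ : ∀ g → 1ₚ *ₚ g ≈ₚ g
  *ₚ-identityˡ g zero    = trans (*ₚ-coeff-zero 1ₚ g) (ℤ.*-identityˡ _)
  *ₚ-identityˡ g (suc n) = begin
    (1ₚ *ₚ g) (suc n)                ≡⟨ *ₚ-coeff-suc 1ₚ g n ⟩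
    1ℤ * g (suc n) + (0ₚ *ₚ g) n     ≡⟨ cong₂ _+_ (ℤ.*-identityˡ (g (suc n))) (*ₚ-zeroˡ g n) ⟩
    g (suc n) + 0ℤ                   ≡⟨ ℤ.+-identityʳ _ ⟩
    g (suc n)                        ∎

  *ₚ-distribˡ : ∀ f g h → f *ₚ (g +ₚ h) ≈ₚ (f *ₚ g) +ₚ (f *ₚ h)
  *ₚ-distribˡ f g h zero = begin
    (f *ₚ (g +ₚ h)) 0          ≡⟨ *ₚ-coeff-zero f (g +ₚ h) ⟩
    f 0 * (g 0 + h 0)          ≡⟨ ℤ.*-distribˡ-+ (f 0) (g 0) (h 0) ⟩
    f 0 * g 0 + f 0 * h 0      ≡⟨ cong₂ _+_ (*ₚ-coeff-zero f g) (*ₚ-coeff-zero f h) ⟨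
    (f *ₚ g) 0 + (f *ₚ h) 0    ∎
  *ₚ-distribˡ f g h (suc n) = begin
    (f *ₚ (g +ₚ h)) (suc n)
      ≡⟨ *ₚ-coeff-suc f (g +ₚ h) n ⟩
    f 0 * (g (suc n) + h (suc n)) + (shift f *ₚ (g +ₚ h)) n
      ≡⟨ cong₂ _+_ (ℤ.*-distribˡ-+ (f 0) _ _) (*ₚ-distribˡ (shift f) g h n) ⟩
    (f 0 * g (suc n) + f 0 * h (suc n)) + ((shift f *ₚ g) n + (shift f *ₚ h) n)
      ≡⟨ +-interchange (f 0 * g (suc n)) _ _ _ ⟩
    (f 0 * g (suc n) + (shift f *ₚ g) n) + (f 0 * h (suc n) + (shift f *ₚ h) n)
      ≡⟨ cong₂ _+_ (*ₚ-coeff-suc f g n) (*ₚ-coeff-suc f h n) ⟨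
    (f *ₚ g) (suc n) + (f *ₚ h) (suc n) ∎

  *ₚ-distribʳ : ∀ h f g → (f +ₚ g) *ₚ h ≈ₚ (f *ₚ h) +ₚ (g *ₚ h)
  *ₚ-distribʳ h f g zero = begin
    ((f +ₚ g) *ₚ h) 0          ≡⟨ *ₚ-coeff-zero (f +ₚ g) h ⟩
    (f 0 + g 0) * h 0          ≡⟨ ℤ.*-distribʳ-+ (h 0) (f 0) (g 0) ⟩
    f 0 * h 0 + g 0 * h 0      ≡⟨ cong₂ _+_ (*ₚ-coeff-zero f h) (*ₚ-coeff-zero g h) ⟨
    (f *ₚ h) 0 + (g *ₚ h) 0    ∎
  *ₚ-distribʳ h f g (suc n) = begin
    ((f +ₚ g) *ₚ h) (suc n)
      ≡⟨ *ₚ-coeff-suc (f +ₚ g) h n ⟩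
    (f 0 + g 0) * h (suc n) + ((shift f +ₚ shift g) *ₚ h) n
      ≡⟨ cong₂ _+_ (ℤ.*-distribʳ-+ (h (suc n)) (f 0) (g 0)) (*ₚ-distribʳ h (shift f) (shift g) n) ⟩
    (f 0 * h (suc n) + g 0 * h (suc n)) + ((shift f *ₚ h) n + (shift g *ₚ h) n)
      ≡⟨ +-interchange (f 0 * h (suc n)) _ _ _ ⟩
    (f 0 * h (suc n) + (shift f *ₚ h) n) + (g 0 * h (suc n) + (shift g *ₚ h) n)
      ≡⟨ cong₂ _+_ (*ₚ-coeff-suc f h n) (*ₚ-coeff-suc g h n) ⟨
    (f *ₚ h) (suc n) + (g *ₚ h) (suc n) ∎

  scale-*ₚ : ∀ a f g → scale a f *ₚ g ≈ₚ scale a (f *ₚ g)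
  scale-*ₚ a f g zero = begin
    (scale a f *ₚ g) 0     ≡⟨ *ₚ-coeff-zero (scale a f) g ⟩
    a * f 0 * g 0          ≡⟨ ℤ.*-assoc a (f 0) (g 0) ⟩
    a * (f 0 * g 0)        ≡⟨ cong (a *_) (*ₚ-coeff-zero f g) ⟨
    a * (f *ₚ g) 0         ∎
  scale-*ₚ a f g (suc n) = begin
    (scale a f *ₚ g) (suc n)
      ≡⟨ *ₚ-coeff-suc (scale a f) g n ⟩
    a * f 0 * g (suc n) + (scale a (shift f) *ₚ g) n
      ≡⟨ cong₂ _+_ (ℤ.*-assoc a (f 0) (g (suc n))) (scale-*ₚ a (shift f) g n) ⟩
    a * (f 0 * g (suc n)) + a * (shift f *ₚ g) n
      ≡⟨ ℤ.*-distribˡ-+ a _ _ ⟨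
    a * (f 0 * g (suc n) + (shift f *ₚ g) n)
      ≡⟨ cong (a *_) (*ₚ-coeff-suc f g n) ⟨
    a * (f *ₚ g) (suc n) ∎

  *ₚ-assoc : ∀ f g h → (f *ₚ g) *ₚ h ≈ₚ f *ₚ (g *ₚ h)
  *ₚ-assoc f g h zero = begin
    ((f *ₚ g) *ₚ h) 0      ≡⟨ *ₚ-coeff-zero (f *ₚ g) h ⟩
    (f *ₚ g) 0 * h 0       ≡⟨ cong (_* h 0) (*ₚ-coeff-zero f g) ⟩
    f 0 * g 0 * h 0        ≡⟨ ℤ.*-assoc (f 0) (g 0) (h 0) ⟩
    f 0 * (g 0 * h 0)      ≡⟨ cong (f 0 *_) (*ₚ-coeff-zero g h) ⟨
    f 0 * (g *ₚ h) 0       ≡⟨ *ₚ-coeff-zero f (g *ₚ h) ⟨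
    (f *ₚ (g *ₚ h)) 0      ∎
  *ₚ-assoc f g h (suc n) = begin
    ((f *ₚ g) *ₚ h) (suc n)
      ≡⟨ *ₚ-coeff-suc (f *ₚ g) h n ⟩
    (f *ₚ g) 0 * h (suc n) + (shift (f *ₚ g) *ₚ h) n
      ≡⟨ cong₂ _+_ (cong (_* h (suc n)) (*ₚ-coeff-zero f g))
                   (*ₚ-cong {g = h} (*ₚ-coeff-suc f g) (λ _ → refl) n) ⟩
    f 0 * g 0 * h (suc n) + ((scale (f 0) (shift g) +ₚ (shift f *ₚ g)) *ₚ h) n
      ≡⟨ cong (_+_ (f 0 * g 0 * h (suc n))) (*ₚ-distribʳ h (scale (f 0) (shift g)) (shift f *ₚ g) n) ⟩
    f 0 * g 0 * h (suc n) + ((scale (f 0) (shift g) *ₚ h) n + ((shift f *ₚ g) *ₚ h) n)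
      ≡⟨ cong₂ (λ x y → f 0 * g 0 * h (suc n) + (x + y))
               (scale-*ₚ (f 0) (shift g) h n) (*ₚ-assoc (shift f) g h n) ⟩
    f 0 * g 0 * h (suc n) + (f 0 * (shift g *ₚ h) n + (shift f *ₚ (g *ₚ h)) n)
      ≡⟨ regroup (f 0) (g 0) (h (suc n)) _ _ ⟩
    f 0 * (g 0 * h (suc n) + (shift g *ₚ h) n) + (shift f *ₚ (g *ₚ h)) n
      ≡⟨ cong (λ x → f 0 * x + (shift f *ₚ (g *ₚ h)) n) (*ₚ-coeff-suc g h n) ⟨
    f 0 * (g *ₚ h) (suc n) + (shift f *ₚ (g *ₚ h)) n
      ≡⟨ *ₚ-coeff-suc f (g *ₚ h) n ⟨
    (f *ₚ (g *ₚ h)) (suc n) ∎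
    where
    regroup : ∀ a b c d e → a * b * c + (a * d + e) ≡ a * (b * c + d) + e
    regroup = solve-∀

  -- Unfolding two coefficients on each side leaves a product of two shifted
  -- series, two indices further down.
  *ₚ-comm : ∀ f g → f *ₚ g ≈ₚ g *ₚ f
  *ₚ-comm f g zero = begin
    (f *ₚ g) 0    ≡⟨ *ₚ-coeff-zero f g ⟩
    f 0 * g 0     ≡⟨ ℤ.*-comm (f 0) (g 0) ⟩
    g 0 * f 0     ≡⟨ *ₚ-coeff-zero g f ⟨
    (g *ₚ f) 0    ∎
  *ₚ-comm f g (suc zero) = begin
    (f *ₚ g) 1                ≡⟨ *ₚ-coeff-suc f g 0 ⟩
    f 0 * g 1 + (shift f *ₚ g) 0  ≡⟨ cong (_+_ (f 0 * g 1)) (*ₚ-coeff-zero (shift f) g) ⟩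
    f 0 * g 1 + f 1 * g 0     ≡⟨ swap (f 0) (g 1) (f 1) (g 0) ⟩
    g 0 * f 1 + g 1 * f 0     ≡⟨ cong (_+_ (g 0 * f 1)) (*ₚ-coeff-zero (shift g) f) ⟨
    g 0 * f 1 + (shift g *ₚ f) 0  ≡⟨ *ₚ-coeff-suc g f 0 ⟨
    (g *ₚ f) 1                ∎
    where
    swap : ∀ a b c d → a * b + c * d ≡ d * c + b * a
    swap = solve-∀
  *ₚ-comm f g (suc (suc n)) = begin
    (f *ₚ g) (suc (suc n))               ≡⟨ *ₚ-coeff-suc f g (suc n) ⟩
    a + (shift f *ₚ g) (suc n)           ≡⟨ cong (_+_ a) (*ₚ-comm (shift f) g (suc n)) ⟩
    a + (g *ₚ shift f) (suc n)           ≡⟨ cong (_+_ a) (*ₚ-coeff-suc g (shift f) n) ⟩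
    a + (b + (shift g *ₚ shift f) n)     ≡⟨ +-exchange a b _ ⟩
    b + (a + (shift g *ₚ shift f) n)     ≡⟨ cong (λ x → b + (a + x)) (*ₚ-comm (shift g) (shift f) n) ⟩
    b + (a + (shift f *ₚ shift g) n)     ≡⟨ cong (_+_ b) (*ₚ-coeff-suc f (shift g) n) ⟨
    b + (f *ₚ shift g) (suc n)           ≡⟨ cong (_+_ b) (*ₚ-comm (shift g) f (suc n)) ⟨
    b + (shift g *ₚ f) (suc n)           ≡⟨ *ₚ-coeff-suc g f (suc n) ⟨
    (g *ₚ f) (suc (suc n))               ∎
    where
    a = f 0 * g (suc (suc n))
    b = g 0 * f (suc (suc n))

  FPS-isCommutativeRing : IsCommutativeRing _≈ₚ_ _+ₚ_ _*ₚ_ -ₚ_ 0ₚ 1ₚ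
  FPS-isCommutativeRing = record
    { isRing = record
      { +-isAbelianGroup = Pointwise.isAbelianGroup ℤ.+-0-isAbelianGroup
      ; *-cong           = *ₚ-cong
      ; *-assoc          = *ₚ-assoc
      ; *-identity       = *ₚ-identityˡ , λ f n → trans (*ₚ-comm f 1ₚ n) (*ₚ-identityˡ f n)
      ; distrib          = *ₚ-distribˡ , *ₚ-distribʳ
      }
    ; *-comm = *ₚ-comm
    }

  FPS-commutativeRing : CommutativeRing 0ℓ 0ℓ
  FPS-commutativeRing = record { isCommutativeRing = FPS-isCommutativeRing }

  ℤ-no-2-torsion : ∀ x → x + x ≡ 0ℤ → x ≡ 0ℤ
  ℤ-no-2-torsion (+ zero) _ = refl

  FPS-no-2-torsion : ∀ f → f +ₚ f ≈ₚ 0ₚ → f ≈ₚ 0ₚ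
  FPS-no-2-torsion f f+f≈0 n = ℤ-no-2-torsion (f n) (f+f≈0 n)

  constₚ-*ₚ-coeff : ∀ a f n → (constₚ a *ₚ f) n ≡ a * f n
  constₚ-*ₚ-coeff a f zero    = *ₚ-coeff-zero (constₚ a) f
  constₚ-*ₚ-coeff a f (suc n) = begin
    (constₚ a *ₚ f) (suc n)              ≡⟨ *ₚ-coeff-suc (constₚ a) f n ⟩
    a * f (suc n) + (0ₚ *ₚ f) n          ≡⟨ cong (_+_ (a * f (suc n))) (*ₚ-zeroˡ f n) ⟩
    a * f (suc n) + 0ℤ                   ≡⟨ ℤ.+-identityʳ _ ⟩
    a * f (suc n)                        ∎

  X-*ₚ-coeff-zero : ∀ f → (X *ₚ f) 0 ≡ 0ℤ
  X-*ₚ-coeff-zero f = *ₚ-coeff-zero X f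

  X-*ₚ-coeff-suc : ∀ f n → (X *ₚ f) (suc n) ≡ f n
  X-*ₚ-coeff-suc f n = begin
    (X *ₚ f) (suc n)                 ≡⟨ *ₚ-coeff-suc X f n ⟩
    0ℤ * f (suc n) + (shift X *ₚ f) n ≡⟨ ℤ.+-identityˡ _ ⟩
    (shift X *ₚ f) n                 ≡⟨ *ₚ-cong {g = f} shift-X≈1 (λ _ → refl) n ⟩
    (1ₚ *ₚ f) n                      ≡⟨ *ₚ-identityˡ f n ⟩
    f n                              ∎
    where
    shift-X≈1 : shift X ≈ₚ 1ₚ
    shift-X≈1 zero    = refl
    shift-X≈1 (suc n) = refl

  -ₚ-*ₚ : ∀ f g → (-ₚ f) *ₚ g ≈ₚ -ₚ (f *ₚ g)
  -ₚ-*ₚ f g n = sym (-‿distribˡ-* f g n)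
    where open import Algebra.Properties.Ring (CommutativeRing.ring FPS-commutativeRing) using (-‿distribˡ-*)

  affine-*ₚ-coeff : ∀ d a f n →
    ((constₚ d -ₚ (X *ₚ constₚ a)) *ₚ f) n ≡ d * f n - (X *ₚ (constₚ a *ₚ f)) n
  affine-*ₚ-coeff d a f n = begin
    ((constₚ d -ₚ (X *ₚ constₚ a)) *ₚ f) n
      ≡⟨ *ₚ-distribʳ f (constₚ d) (-ₚ (X *ₚ constₚ a)) n ⟩
    (constₚ d *ₚ f) n + ((-ₚ (X *ₚ constₚ a)) *ₚ f) n
      ≡⟨ cong₂ _+_ (constₚ-*ₚ-coeff d f n) (-ₚ-*ₚ (X *ₚ constₚ a) f n) ⟩
    d * f n - ((X *ₚ constₚ a) *ₚ f) n
      ≡⟨ cong (λ x → d * f n - x) (*ₚ-assoc X (constₚ a) f n) ⟩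
    d * f n - (X *ₚ (constₚ a *ₚ f)) n ∎

module IntegerSums where

  open import Data.Nat as ℕ using (ℕ; zero; suc; _≡ᵇ_; _<ᵇ_)
  open import Data.Integer using (ℤ; 0ℤ; 1ℤ; _+_; _-_; _*_)
  import Data.Integer.Properties as ℤ
  open import Data.Integer.Tactic.RingSolver using (solve-∀)
  open import Algebra.Properties.CommutativeMonoid.Sum ℤ.+-0-commutativeMonoid
    using (sum-syntax; ∑-distrib-+; sum-replicate-zero; sum-cong-≗)
  open import Data.Bool using (Bool; true; false; if_then_else_; T)
  open import Data.Bool.Properties using (T?)
  open import Data.Fin using (Fin; zero; suc; toℕ)
  open import Data.List using (List; []; _∷_; _++_; map; filter; concatMap; applyUpTo; length; lookup)
  open import Data.List.Properties using (map-++)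
  open import Function using (_∘_)
  open import Relation.Binary.PropositionalEquality
  open ≡-Reasoning

  ind : Bool → ℤ
  ind b = if b then 1ℤ else 0ℤ

  ind-true-* : ∀ {b} x → T b → ind b * x ≡ x
  ind-true-* {true} x _ = ℤ.*-identityˡ x

  sumℤ-++ : ∀ xs ys → sumℤ (xs ++ ys) ≡ sumℤ xs + sumℤ ys
  sumℤ-++ []       ys = sym (ℤ.+-identityˡ (sumℤ ys))
  sumℤ-++ (x ∷ xs) ys = trans (cong (_+_ x) (sumℤ-++ xs ys)) (sym (ℤ.+-assoc x (sumℤ xs) (sumℤ ys)))

  sumℤ-concatMap : ∀ {A B : Set} (f : B → ℤ) (g : A → List B) xs →
    sumℤ (map f (concatMap g xs)) ≡ sumℤ (map (λ x → sumℤ (map f (g x))) xs)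
  sumℤ-concatMap f g []       = refl
  sumℤ-concatMap f g (x ∷ xs) = begin
    sumℤ (map f (g x ++ concatMap g xs))                ≡⟨ cong sumℤ (map-++ f (g x) (concatMap g xs)) ⟩
    sumℤ (map f (g x) ++ map f (concatMap g xs))        ≡⟨ sumℤ-++ (map f (g x)) _ ⟩
    sumℤ (map f (g x)) + sumℤ (map f (concatMap g xs))  ≡⟨ cong (_+_ (sumℤ (map f (g x)))) (sumℤ-concatMap f g xs) ⟩
    sumℤ (map f (g x)) + sumℤ (map (λ x → sumℤ (map f (g x))) xs) ∎

  sumℤ-filter : ∀ {A : Set} (f : A → ℤ) (p : A → Bool) xs →
    sumℤ (map f (filter (λ x → T? (p x)) xs)) ≡ sumℤ (map (λ x → ind (p x) * f x) xs)
  sumℤ-filter f p []       = refl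
  sumℤ-filter f p (x ∷ xs) with p x
  ... | true  = cong₂ _+_ (sym (ℤ.*-identityˡ (f x))) (sumℤ-filter f p xs)
  ... | false = trans (sumℤ-filter f p xs) (sym (ℤ.+-identityˡ _))

  sumℤ-lookup : ∀ {A : Set} (xs : List A) (f : A → ℤ) → ∑[ b < length xs ] f (lookup xs b) ≡ sumℤ (map f xs)
  sumℤ-lookup []       f = refl
  sumℤ-lookup (x ∷ xs) f = cong (_+_ (f x)) (sumℤ-lookup xs f)

  ∑-δ : ∀ {k} (a : Fin k) (v : Fin k → ℤ) → ∑[ b < k ] (δ a b * v b) ≡ v a
  ∑-δ {suc k} zero    v = trans (cong₂ _+_ (ℤ.*-identityˡ (v zero)) (sum-replicate-zero k)) (ℤ.+-identityʳ _)
  ∑-δ {suc k} (suc a) v = trans (ℤ.+-identityˡ _) (∑-δ a (v ∘ suc))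

  ∑-distrib-- : ∀ {k} (f g : Fin k → ℤ) → ∑[ b < k ] (f b - g b) ≡ ∑[ b < k ] f b - ∑[ b < k ] g b
  ∑-distrib-- {zero}  f g = refl
  ∑-distrib-- {suc k} f g = trans (cong (_+_ (f zero - g zero)) (∑-distrib-- (f ∘ suc) (g ∘ suc)))
                                  (regroup (f zero) (g zero) _ _)
    where
    regroup : ∀ a b c d → (a - b) + (c - d) ≡ (a + c) - (b + d)
    regroup = solve-∀

  sumUpTo : ℕ → (ℕ → ℤ) → ℤ
  sumUpTo Q f = ∑[ x < Q ] f (toℕ x)

  sumUpTo-cong : ∀ Q {f g : ℕ → ℤ} → (∀ x → f x ≡ g x) → sumUpTo Q f ≡ sumUpTo Q g
  sumUpTo-cong Q f≗g = sum-cong-≗ {Q} (f≗g ∘ toℕ)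

  sumUpTo-+ : ∀ Q (f g : ℕ → ℤ) → sumUpTo Q (λ x → f x + g x) ≡ sumUpTo Q f + sumUpTo Q g
  sumUpTo-+ Q f g = ∑-distrib-+ {Q} (f ∘ toℕ) (g ∘ toℕ)

  sumUpTo-zero : ∀ Q → sumUpTo Q (λ _ → 0ℤ) ≡ 0ℤ
  sumUpTo-zero = sum-replicate-zero

  sumℤ-applyUpTo : ∀ (f : ℕ → ℤ) (g : ℕ → ℕ) Q → sumℤ (map f (applyUpTo g Q)) ≡ sumUpTo Q (f ∘ g)
  sumℤ-applyUpTo f g zero    = refl
  sumℤ-applyUpTo f g (suc Q) = cong (_+_ (f (g 0))) (sumℤ-applyUpTo f (g ∘ suc) Q)

  sumUpTo-δ : ∀ Q t (f : ℕ → ℤ) → sumUpTo Q (λ x → ind (t ≡ᵇ x) * f x) ≡ ind (t <ᵇ Q) * f t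
  sumUpTo-δ zero    t       f = refl
  sumUpTo-δ (suc Q) zero    f = trans (cong (_+_ (1ℤ * f 0)) (sumUpTo-zero Q)) (ℤ.+-identityʳ _)
  sumUpTo-δ (suc Q) (suc t) f = trans (ℤ.+-identityˡ _) (sumUpTo-δ Q t (f ∘ suc))


module Walks where

  open IntegerSums
  open import Data.Nat as ℕ using (ℕ; zero; suc; _<_; _≡ᵇ_; _<ᵇ_)
  import Data.Nat.Properties as ℕ
  open import Data.Integer using (ℤ; +_; 0ℤ; 1ℤ; _+_; _*_)
  import Data.Integer.Properties as ℤ
  open import Data.Integer.Tactic.RingSolver using (solve-∀)
  open import Data.Bool using (Bool; true; false; _∧_; not)
  open import Data.Bool.Properties using (T?)
  open import Data.List using (List; []; _∷_; map; filter; concatMap; upTo; length)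
  open import Data.List.Properties using (map-cong; map-∘)
  open import Data.Maybe using (Maybe; just)
  open import Data.Product using (_×_; _,_)
  open import Function using (_∘_; id)
  open import Relation.Binary.PropositionalEquality
  open ≡-Reasoning

  countℤ : (List Step → Bool) → List (List Step) → ℤ
  countℤ p ws = sumℤ (map (ind ∘ p) ws)

  length-filter≡countℤ : ∀ p ws → + length (filter (λ w → T? (p w)) ws) ≡ countℤ p ws
  length-filter≡countℤ p []       = refl
  length-filter≡countℤ p (w ∷ ws) with p w
  ... | true  = cong (_+_ 1ℤ) (length-filter≡countℤ p ws)
  ... | false = trans (length-filter≡countℤ p ws) (sym (ℤ.+-identityˡ _))

  countℤ-false : ∀ ws → countℤ (λ _ → false) ws ≡ 0ℤ
  countℤ-false []       = refl
  countℤ-false (w ∷ ws) = cong (_+_ 0ℤ) (countℤ-false ws)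

  countℤ-∧ : ∀ b p ws → countℤ (λ w → b ∧ p w) ws ≡ ind b * countℤ p ws
  countℤ-∧ true  p ws = sym (ℤ.*-identityˡ (countℤ p ws))
  countℤ-∧ false p ws = countℤ-false ws

  countℤ-extensions : ∀ p ws →
    countℤ p (concatMap (λ w → (N ∷ w) ∷ (S ∷ w) ∷ (E ∷ w) ∷ []) ws) ≡
    countℤ (p ∘ (N ∷_)) ws + countℤ (p ∘ (S ∷_)) ws + countℤ (p ∘ (E ∷_)) ws
  countℤ-extensions p []       = refl
  countℤ-extensions p (w ∷ ws) = begin
    ιN + (ιS + (ιE + countℤ p (concatMap _ ws)))   ≡⟨ cong (λ x → ιN + (ιS + (ιE + x))) (countℤ-extensions p ws) ⟩
    ιN + (ιS + (ιE + (cN + cS + cE)))             ≡⟨ regroup ιN ιS ιE cN cS cE ⟩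
    (ιN + cN) + (ιS + cS) + (ιE + cE)             ∎
    where
    ιN = ind (p (N ∷ w))
    ιS = ind (p (S ∷ w))
    ιE = ind (p (E ∷ w))
    cN = countℤ (p ∘ (N ∷_)) ws
    cS = countℤ (p ∘ (S ∷_)) ws
    cE = countℤ (p ∘ (E ∷_)) ws
    regroup : ∀ a b c x y z → a + (b + (c + (x + y + z))) ≡ (a + x) + (b + y) + (c + z)
    regroup = solve-∀

  walks : ℕ → ℕ → Maybe Step → ℕ → ℤ
  walks m y p n = countℤ (validFrom m y p) (words n)

  north south : ℕ → ℕ → Maybe Step → ℕ → ℤ
  north m y       p n = ind (not (retraces p N)) * (ind (y <ᵇ m) * walks m (suc y) (just N) n)
  south m zero    p n = 0ℤ
  south m (suc y) p n = ind (not (retraces p S)) * walks m y (just S) n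

  walks-suc : ∀ m y p n → walks m y p (suc n) ≡ north m y p n + south m y p n + walks m y (just E) n
  walks-suc m y p n = begin
    walks m y p (suc n)
      ≡⟨ countℤ-extensions (validFrom m y p) (words n) ⟩
    countℤ (validFrom m y p ∘ (N ∷_)) (words n) + countℤ (validFrom m y p ∘ (S ∷_)) (words n)
      + walks m y (just E) n
      ≡⟨ cong₂ (λ a b → a + b + walks m y (just E) n) northward (southward y) ⟩
    north m y p n + south m y p n + walks m y (just E) n ∎
    where
    northward : countℤ (validFrom m y p ∘ (N ∷_)) (words n) ≡ north m y p n
    northward = trans (countℤ-∧ (not (retraces p N)) _ (words n))
                      (cong (ind (not (retraces p N)) *_) (countℤ-∧ (y <ᵇ m) _ (words n)))
    southward : ∀ y → countℤ (validFrom m y p ∘ (S ∷_)) (words n) ≡ south m y p n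
    southward zero    = countℤ-false (words n)
    southward (suc y) = countℤ-∧ (not (retraces p S)) _ (words n)

  arrival : ℕ → ℕ → Maybe Step
  arrival (suc i)    (suc j)    = arrival i j
  arrival zero       (suc zero) = just N
  arrival (suc zero) zero       = just S
  arrival _          _          = just E

  walksFrom : ℕ → ℕ × ℕ → ℕ → ℤ
  walksFrom m (i , j) = walks m j (arrival i j)

  arrival-flat : ∀ j → arrival j j ≡ just E
  arrival-flat zero    = refl
  arrival-flat (suc j) = arrival-flat j

  arrival-up : ∀ j → arrival j (suc j) ≡ just N
  arrival-up zero    = refl
  arrival-up (suc j) = arrival-up j

  arrival-down : ∀ j → arrival (suc j) j ≡ just S
  arrival-down zero    = refl
  arrival-down (suc j) = arrival-down j

  ≡ᵇ-refl : ∀ n → (n ≡ᵇ n) ≡ true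
  ≡ᵇ-refl zero    = refl
  ≡ᵇ-refl (suc n) = ≡ᵇ-refl n

  edge-flat : ∀ i j → edge (i , j) (j , j) ≡ true
  edge-flat zero          zero          = refl
  edge-flat zero          (suc zero)    = refl
  edge-flat zero          (suc (suc j)) rewrite ≡ᵇ-refl j = refl
  edge-flat (suc zero)    zero          = refl
  edge-flat (suc (suc i)) zero          = refl
  edge-flat (suc i)       (suc j)       = edge-flat i j

  edge-up : ∀ i j → edge (i , j) (j , suc j) ≡ not (retraces (arrival i j) N)
  edge-up zero          zero          = refl
  edge-up zero          (suc zero)    = refl
  edge-up zero          (suc (suc j)) rewrite ≡ᵇ-refl j = refl
  edge-up (suc zero)    zero          = refl
  edge-up (suc (suc i)) zero          = refl
  edge-up (suc i)       (suc j)       = edge-up i j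

  edge-down : ∀ i j → edge (i , suc j) (suc j , j) ≡ not (retraces (arrival i (suc j)) S)
  edge-down zero                zero    = refl
  edge-down zero                (suc j) rewrite ≡ᵇ-refl j = refl
  edge-down (suc zero)          zero    = refl
  edge-down (suc (suc zero))    zero    = refl
  edge-down (suc (suc (suc i))) zero    = refl
  edge-down (suc i)             (suc j) = edge-down i j

  sum-vertices : ∀ m (F : ℕ × ℕ → ℤ) →
    sumℤ (map F (vertices m)) ≡ sumUpTo (suc m) (λ i → sumUpTo (suc m) (λ k → ind (near i k) * F (i , k)))
  sum-vertices m F = begin
    sumℤ (map F (concatMap row (upTo (suc m))))               ≡⟨ sumℤ-concatMap F row (upTo (suc m)) ⟩
    sumℤ (map (λ i → sumℤ (map F (row i))) (upTo (suc m)))    ≡⟨ cong sumℤ (map-cong row-sum (upTo (suc m))) ⟩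
    sumℤ (map Row (upTo (suc m)))
                                                               ≡⟨ sumℤ-applyUpTo Row id (suc m) ⟩
    sumUpTo (suc m) Row ∎
    where
    Row : ℕ → ℤ
    Row i = sumUpTo (suc m) (λ k → ind (near i k) * F (i , k))
    row : ℕ → List (ℕ × ℕ)
    row i = map (i ,_) (filter (λ k → T? (near i k)) (upTo (suc m)))
    row-sum : ∀ i → sumℤ (map F (row i)) ≡ Row i
    row-sum i = begin
      sumℤ (map F (row i))
        ≡⟨ cong sumℤ (map-∘ {g = F} {f = i ,_} (filter (λ k → T? (near i k)) (upTo (suc m)))) ⟨
      sumℤ (map (F ∘ (i ,_)) (filter (λ k → T? (near i k)) (upTo (suc m))))
        ≡⟨ sumℤ-filter (F ∘ (i ,_)) (near i) (upTo (suc m)) ⟩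
      sumℤ (map (λ k → ind (near i k) * F (i , k)) (upTo (suc m)))
        ≡⟨ sumℤ-applyUpTo (λ k → ind (near i k) * F (i , k)) id (suc m) ⟩
      Row i ∎

  ind-near : ∀ j k → ind (near j k) ≡ ind (j ≡ᵇ k) + (ind (suc j ≡ᵇ k) + ind (j ≡ᵇ suc k))
  ind-near zero          zero          = refl
  ind-near zero          (suc zero)    = refl
  ind-near zero          (suc (suc k)) = refl
  ind-near (suc zero)    zero          = refl
  ind-near (suc (suc j)) zero          = refl
  ind-near (suc j)       (suc k)       = ind-near j k

  below : (ℕ × ℕ → ℤ) → ℕ → ℤ
  below F zero    = 0ℤ
  below F (suc j) = F (suc j , j)

  -- Row j of the vertex list consists of (j , j), (j , j + 1) if j < m, and
  -- (j , j - 1) if j > 0.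
  sum-vertices-row : ∀ m j (F : ℕ × ℕ → ℤ) → j < suc m →
    (∀ i k → (j ≡ᵇ i) ≡ false → F (i , k) ≡ 0ℤ) →
    sumℤ (map F (vertices m)) ≡ F (j , j) + (ind (j <ᵇ m) * F (j , suc j) + below F j)
  sum-vertices-row m j F j<m+1 F-off-row = begin
    sumℤ (map F (vertices m))
      ≡⟨ sum-vertices m F ⟩
    sumUpTo (suc m) Row
      ≡⟨ sumUpTo-cong (suc m) Row-on-row ⟩
    sumUpTo (suc m) (λ i → ind (j ≡ᵇ i) * Row i)
      ≡⟨ sumUpTo-δ (suc m) j Row ⟩
    ind (j <ᵇ suc m) * Row j
      ≡⟨ ind-true-* (Row j) (ℕ.<⇒<ᵇ j<m+1) ⟩
    Row j
      ≡⟨ sumUpTo-cong (suc m) split ⟩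
    sumUpTo (suc m) (λ k → here k + (up k + down k))
      ≡⟨ sumUpTo-+ (suc m) here (λ k → up k + down k) ⟩
    sumUpTo (suc m) here + sumUpTo (suc m) (λ k → up k + down k)
      ≡⟨ cong (_+_ (sumUpTo (suc m) here)) (sumUpTo-+ (suc m) up down) ⟩
    sumUpTo (suc m) here + (sumUpTo (suc m) up + sumUpTo (suc m) down)
      ≡⟨ cong₂ (λ a b → a + (b + sumUpTo (suc m) down))
               (sumUpTo-δ (suc m) j (λ k → F (j , k))) (sumUpTo-δ (suc m) (suc j) (λ k → F (j , k))) ⟩
    ind (j <ᵇ suc m) * F (j , j) + (ind (j <ᵇ m) * F (j , suc j) + sumUpTo (suc m) down)
      ≡⟨ cong₂ (λ a b → a + (ind (j <ᵇ m) * F (j , suc j) + b))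
               (ind-true-* (F (j , j)) (ℕ.<⇒<ᵇ j<m+1)) (below-sum j j<m+1) ⟩
    F (j , j) + (ind (j <ᵇ m) * F (j , suc j) + below F j) ∎
    where
    Row : ℕ → ℤ
    Row i = sumUpTo (suc m) (λ k → ind (near i k) * F (i , k))
    Row-on-row : ∀ i → Row i ≡ ind (j ≡ᵇ i) * Row i
    Row-on-row i with j ≡ᵇ i in j≢i
    ... | true  = sym (ℤ.*-identityˡ (Row i))
    ... | false = trans (sumUpTo-cong (suc m) vanishes) (sumUpTo-zero (suc m))
      where
      vanishes : ∀ k → ind (near i k) * F (i , k) ≡ 0ℤ
      vanishes k = trans (cong (ind (near i k) *_) (F-off-row i k j≢i)) (ℤ.*-zeroʳ (ind (near i k)))
    here up down : ℕ → ℤ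
    here k = ind (j ≡ᵇ k) * F (j , k)
    up   k = ind (suc j ≡ᵇ k) * F (j , k)
    down k = ind (j ≡ᵇ suc k) * F (j , k)
    split : ∀ k → ind (near j k) * F (j , k) ≡ here k + (up k + down k)
    split k = begin
      ind (near j k) * F (j , k)
        ≡⟨ cong (_* F (j , k)) (ind-near j k) ⟩
      (ind (j ≡ᵇ k) + (ind (suc j ≡ᵇ k) + ind (j ≡ᵇ suc k))) * F (j , k)
        ≡⟨ ℤ.*-distribʳ-+ (F (j , k)) (ind (j ≡ᵇ k)) _ ⟩
      here k + (ind (suc j ≡ᵇ k) + ind (j ≡ᵇ suc k)) * F (j , k)
        ≡⟨ cong (_+_ (here k)) (ℤ.*-distribʳ-+ (F (j , k)) (ind (suc j ≡ᵇ k)) (ind (j ≡ᵇ suc k))) ⟩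
      here k + (up k + down k) ∎
    below-sum : ∀ j → j < suc m → sumUpTo (suc m) (λ k → ind (j ≡ᵇ suc k) * F (j , k)) ≡ below F j
    below-sum zero    _       = sumUpTo-zero (suc m)
    below-sum (suc j) j<m     = trans (sumUpTo-δ (suc m) j (λ k → F (suc j , k)))
      (ind-true-* (F (suc j , j)) (ℕ.<⇒<ᵇ (ℕ.m<n⇒m<1+n (ℕ.s<s⁻¹ j<m))))

  walksFrom-suc : ∀ m i j n → j < suc m →
    walksFrom m (i , j) (suc n) ≡ sumℤ (map (λ v → ind (edge (i , j) v) * walksFrom m v n) (vertices m))
  walksFrom-suc m i j n j<m+1 = sym (begin
    sumℤ (map F (vertices m))
      ≡⟨ sum-vertices-row m j F j<m+1 F-off-row ⟩
    F (j , j) + (ind (j <ᵇ m) * F (j , suc j) + below F j)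
      ≡⟨ cong₂ (λ a b → a + (ind (j <ᵇ m) * b + below F j)) F-flat F-up ⟩
    wE + (ind (j <ᵇ m) * (ind (not (retraces p N)) * wN) + below F j)
      ≡⟨ cong (λ b → wE + (ind (j <ᵇ m) * (ind (not (retraces p N)) * wN) + b)) (F-down j) ⟩
    wE + (ind (j <ᵇ m) * (ind (not (retraces p N)) * wN) + south m j p n)
      ≡⟨ reorder wE (ind (j <ᵇ m)) (ind (not (retraces p N))) wN (south m j p n) ⟩
    ind (not (retraces p N)) * (ind (j <ᵇ m) * wN) + south m j p n + wE
      ≡⟨ walks-suc m j p n ⟨
    walks m j p (suc n) ∎)
    where
    p = arrival i j
    wN = walks m (suc j) (just N) n
    wE = walks m j (just E) n
    F : ℕ × ℕ → ℤ
    F v = ind (edge (i , j) v) * walksFrom m v n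
    F-off-row : ∀ i′ k → (j ≡ᵇ i′) ≡ false → F (i′ , k) ≡ 0ℤ
    F-off-row i′ k j≢i′ rewrite j≢i′ = refl
    F-flat : F (j , j) ≡ wE
    F-flat rewrite edge-flat i j | arrival-flat j = ℤ.*-identityˡ wE
    F-up : F (j , suc j) ≡ ind (not (retraces p N)) * wN
    F-up rewrite edge-up i j | arrival-up j = refl
    F-down : ∀ j → below (λ v → ind (edge (i , j) v) * walksFrom m v n) j ≡ south m j (arrival i j) n
    F-down zero    = refl
    F-down (suc j) rewrite edge-down i j | arrival-down j = refl
    reorder : ∀ e a b w s → e + (a * (b * w) + s) ≡ b * (a * w) + s + e
    reorder = solve-∀

open PowerSeries
open IntegerSums
open Walks

open import Data.Nat using (zero; suc; _<_)
open import Data.Integer using (ℤ; 0ℤ; _+_; _-_; _*_)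
import Data.Integer.Properties as ℤ
open import Algebra.Properties.CommutativeMonoid.Sum ℤ.+-0-commutativeMonoid
  using (sum-syntax; sum-replicate-zero; sum-cong-≗)
import Algebra.Properties.Semiring.Sum (CommutativeRing.semiring FPS-commutativeRing) as Σₚ
open import Data.Bool.Properties using (T?)
open import Data.Fin using (Fin; zero; suc)
open import Data.List using (List; _∷_; []; map; filter; upTo)
open import Data.List.Properties using (map-cong)
open import Data.List.Membership.Propositional.Properties using (∈-lookup)
open import Data.List.Relation.Unary.All as All using (All; universal)
open import Data.List.Relation.Unary.All.Properties using (concat⁺; map⁺; filter⁺; applyUpTo⁺₁)
open import Data.Maybe using (nothing; just)
open import Data.Product using (_×_; _,_; proj₂)
open import Function using (_∘_; id)
open import Relation.Binary.PropositionalEquality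
open ≡-Reasoning

open Determinant FPS-commutativeRing
  using (sgn; minor; determinant; determinant-cong; _[col0≔_]; cramer-col0)

sumFin≡sum : ∀ {k} {f g : Fin k → FPS} → (∀ i → f i ≡ g i) → sumFin f ≡ Σₚ.sum g
sumFin≡sum {zero}  f≡g = refl
sumFin≡sum {suc k} f≡g = cong₂ _+ₚ_ (f≡g zero) (sumFin≡sum (f≡g ∘ suc))

sign≡sgn : ∀ {k} (i : Fin k) → sign i ≡ sgn i
sign≡sgn zero    = refl
sign≡sgn (suc i) = cong -ₚ_ (sign≡sgn i)

det≡determinant : ∀ {k} (M : Matrix k) → det M ≡ determinant M
det≡determinant {zero}  M = refl
det≡determinant {suc k} M = sumFin≡sum λ i →
  cong₂ _*ₚ_ (cong (_*ₚ M i zero) (sign≡sgn i)) (det≡determinant (minor M i))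

replaceFirstCol≡[col0≔1] : ∀ {k} (M : Matrix (suc k)) r s →
  replaceFirstCol M r s ≡ (M [col0≔ (λ _ → 1ₚ) ]) r s
replaceFirstCol≡[col0≔1] M r zero    = refl
replaceFirstCol≡[col0≔1] M r (suc s) = refl

sumₚ-coeff : ∀ {k} (F : Fin k → FPS) n → Σₚ.sum F n ≡ ∑[ b < k ] F b n
sumₚ-coeff {zero}  F n = refl
sumₚ-coeff {suc k} F n = cong (_+_ (F zero n)) (sumₚ-coeff (F ∘ suc) n)

Y : (m : ℕ) → Fin (nV m) → FPS
Y m b = walksFrom m (vertex m b)

validFrom-nothing : ∀ m y w → validFrom m y nothing w ≡ validFrom m y (just E) w
validFrom-nothing m y       []      = refl
validFrom-nothing m y       (N ∷ w) = refl
validFrom-nothing m zero    (S ∷ w) = refl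
validFrom-nothing m (suc y) (S ∷ w) = refl
validFrom-nothing m y       (E ∷ w) = refl

C≈Y₀ : ∀ m → C m ≈ₚ Y m zero
C≈Y₀ m n = trans (length-filter≡countℤ (isMonotonePath m) (words n))
                 (cong sumℤ (map-cong (cong ind ∘ validFrom-nothing m 0) (words n)))

vertex-height : ∀ m a → proj₂ (vertex m a) < suc m
vertex-height m a = All.lookup heights (∈-lookup a)
  where
  row : ℕ → List (ℕ × ℕ)
  row i = map (i ,_) (filter (λ k → T? (near i k)) (upTo (suc m)))
  heights : All (λ v → proj₂ v < suc m) (vertices m)
  heights = concat⁺ (map⁺ {f = row} (universal row-heights (upTo (suc m))))
    where
    row-heights : ∀ i → All (λ v → proj₂ v < suc m) (row i)
    row-heights i = map⁺ (filter⁺ (λ k → T? (near i k)) (applyUpTo⁺₁ id (suc m) id))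

A-row-transfer : ∀ m a n → ∑[ b < nV m ] (A m a b * Y m b n) ≡ Y m a (suc n)
A-row-transfer m a n = begin
  ∑[ b < nV m ] (A m a b * Y m b n)   ≡⟨ sumℤ-lookup (vertices m) F ⟩
  sumℤ (map F (vertices m))            ≡⟨ walksFrom-suc m _ _ n (vertex-height m a) ⟨
  Y m a (suc n)                        ∎
  where
  F : ℕ × ℕ → ℤ
  F v = ind (edge (vertex m a) v) * walksFrom m v n

I-xA-Y≈1 : ∀ m a → Σₚ.sum (λ b → I-xA m a b *ₚ Y m b) ≈ₚ 1ₚ
I-xA-Y≈1 m a n = begin
  Σₚ.sum (λ b → I-xA m a b *ₚ Y m b) n
    ≡⟨ sumₚ-coeff (λ b → I-xA m a b *ₚ Y m b) n ⟩
  ∑[ b < nV m ] (I-xA m a b *ₚ Y m b) n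
    ≡⟨ sum-cong-≗ {nV m} (λ b → affine-*ₚ-coeff (δ a b) (A m a b) (Y m b) n) ⟩
  ∑[ b < nV m ] (δ a b * Y m b n - XAY b n)
    ≡⟨ ∑-distrib-- (λ b → δ a b * Y m b n) (λ b → XAY b n) ⟩
  ∑[ b < nV m ] (δ a b * Y m b n) - ∑[ b < nV m ] XAY b n
    ≡⟨ cong₂ _-_ (∑-δ a (λ b → Y m b n)) (∑XAY n) ⟩
  Y m a n - shiftedY n
    ≡⟨ cancel n ⟩
  1ₚ n ∎
  where
  XAY : Fin (nV m) → FPS
  XAY b = X *ₚ (constₚ (A m a b) *ₚ Y m b)
  shiftedY : ℕ → ℤ
  shiftedY zero    = 0ℤ
  shiftedY (suc n) = Y m a (suc n)
  ∑XAY : ∀ n → ∑[ b < nV m ] XAY b n ≡ shiftedY n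
  ∑XAY zero    = trans (sum-cong-≗ {nV m} (λ b → X-*ₚ-coeff-zero (constₚ (A m a b) *ₚ Y m b)))
                       (sum-replicate-zero (nV m))
  ∑XAY (suc n) = trans (sum-cong-≗ {nV m} (λ b → trans (X-*ₚ-coeff-suc (constₚ (A m a b) *ₚ Y m b) n)
                                                       (constₚ-*ₚ-coeff (A m a b) (Y m b) n)))
                       (A-row-transfer m a n)
  cancel : ∀ n → Y m a n - shiftedY n ≡ 1ₚ n
  cancel zero    = refl
  cancel (suc n) = ℤ.+-inverseʳ (Y m a (suc n))

theorem2p6 : (m : ℕ) → 1 ≤ m → (n : ℕ) → (det (I-xA m) *ₚ C m) n ≡ det (replaceFirstCol (I-xA m)) n
theorem2p6 m _ n = begin
  (det (I-xA m) *ₚ C m) n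
    ≡⟨ *ₚ-cong (cong-app (det≡determinant (I-xA m))) (C≈Y₀ m) n ⟩
  (determinant (I-xA m) *ₚ Y m zero) n
    ≡⟨ cramer-col0 FPS-no-2-torsion (I-xA m) (Y m) (λ _ → 1ₚ) (I-xA-Y≈1 m) n ⟩
  determinant (I-xA m [col0≔ (λ _ → 1ₚ) ]) n
    ≡⟨ determinant-cong (λ r s → cong-app (replaceFirstCol≡[col0≔1] (I-xA m) r s)) n ⟨
  determinant (replaceFirstCol (I-xA m)) n
    ≡⟨ cong-app (det≡determinant (replaceFirstCol (I-xA m))) n ⟨
  det (replaceFirstCol (I-xA m)) n ∎
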